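{- Let $T_b$ be a binary tree and let $T_1=\tau_1(T_b)$. Then the string consisting of one open parenthesis followed by Zaks' sequence of $T_b$ is equal to the BP sequence of $T_1$.
   Context: Zaks' sequence of a binary tree $T_b$ with $n$ nodes: extend $T_b$ by adding an external node wherever a child is missing; label every original (internal) node with an open parenthesis and every external node with a close parenthesis; traverse the extended tree in preorder and output the labels of visited nodes (a string of length $2n+1$). Transformation $\tau_1$: $T_1$ is an ordinal tree (rooted, ordered children) with $n+1$ nodes, namely a dummy root and a node $v(u)$ for each node $u$ of $T_b$. The children of the dummy root are, in order, $v(x_0),\dots,v(x_k)$ where $x_0$ is the root of $T_b$ and $x_{j+1}$ is the right child of $x_j$, up to the last one having no right child. For each node $u$ of $T_b$, the left child of $u$ corresponds to the first child of $v(u)$ and the right child of $u$ corresponds to the next sibling of $v(u)$. BP sequence of an ordinal tree: in a depth-first traversal (children left to right), write an open parenthesis when a node is first visited and a close parenthesis immediately after all of its descendants have been visited. -}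

module Defs where

open import Data.List using (List; []; _∷_; _++_)

data Paren : Set where
  open′ close′ : Paren

-- Binary trees; `leaf` is the empty tree (a missing child), `node l r` an
-- (internal) node with left subtree l and right subtree r.
data BTree : Set where
  leaf : BTree
  node : BTree → BTree → BTree

-- Zaks' sequence: extend the tree by external nodes (the `leaf`s), label
-- internal nodes '(' and external nodes ')', output labels in preorder.
zaks : BTree → List Paren
zaks leaf       = close′ ∷ []
zaks (node l r) = open′ ∷ (zaks l ++ zaks r)

data OTree : Set where
  onode : List OTree → OTree

mutual
  bp : OTree → List Paren
  bp (onode cs) = open′ ∷ (bpList cs ++ close′ ∷ [])

  bpList : List OTree → List Paren
  bpList []       = []
  bpList (t ∷ ts) = bp t ++ bpList ts

-- rightChain t = [v(x₀), …, v(x_k)] where x₀ is the root of t and x_{j+1} is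
-- the right child of x_j.  Each v(u) has as children the right chain starting
-- at the left child of u (first child = left child, next sibling = right child).
rightChain : BTree → List OTree
rightChain leaf       = []
rightChain (node l r) = onode (rightChain l) ∷ rightChain r

-- τ₁: dummy root whose children are the right chain from the root of T_b.
tau1 : BTree → OTree
tau1 t = onode (rightChain t)

module Submission where

-- Strengthen to the forest of a right chain: Zaks' word of a node is '(', then
-- the left subtree's word, whose trailing ')' closes v(node), then the right
-- subtree's word, which continues the sibling list and ends with the one ')'
-- left over at the bottom of the right spine.

open import Defs
open import Data.List using (_∷_; []; _++_)
open import Data.List.Properties using (++-assoc)
open import Relation.Binary.PropositionalEquality using (_≡_; refl; cong; cong₂; sym; module ≡-Reasoning)
open ≡-Reasoning

zaks≡bpList-rightChain : (t : BTree) → zaks t ≡ bpList (rightChain t) ++ close′ ∷ []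
zaks≡bpList-rightChain leaf       = refl
zaks≡bpList-rightChain (node l r) = cong (open′ ∷_) (begin
  zaks l ++ zaks r
    ≡⟨ cong₂ _++_ (zaks≡bpList-rightChain l) (zaks≡bpList-rightChain r) ⟩
  (bpList (rightChain l) ++ close′ ∷ []) ++ bpList (rightChain r) ++ close′ ∷ []
    ≡⟨ sym (++-assoc (bpList (rightChain l) ++ close′ ∷ []) (bpList (rightChain r)) (close′ ∷ [])) ⟩
  ((bpList (rightChain l) ++ close′ ∷ []) ++ bpList (rightChain r)) ++ close′ ∷ [] ∎)

theorem4 : (Tb : BTree) → open′ ∷ zaks Tb ≡ bp (tau1 Tb)
theorem4 Tb = cong (open′ ∷_) (zaks≡bpList-rightChain Tb)
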